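{- Let $r$ be a nonnegative integer, let $\mathbf{a}=(a_1,a_2,\ldots)$ be a sequence of real numbers with $a_1\neq0$, let $A(t)=\sum_{j\ge1}a_j\frac{t^j}{j!}$ and let $\overline{A}(t)=\sum_{j\ge1}\overline{a}_j\frac{t^j}{j!}$ be its compositional inverse, $\overline{\mathbf{a}}=(\overline{a}_1,\overline{a}_2,\ldots)$. Then for sequences of real numbers $(U_n)_{n\ge0}$, $(V_n)_{n\ge0}$, $$U_n=\sum_{k=0}^{n}B^{(r)}_{n+r,k+r}(\mathbf{a})V_k\ \text{ for all } n\ge0\iff V_n=\sum_{k=0}^{n}B^{(r)}_{n+r,k+r}(\overline{\mathbf{a}})U_k\ \text{ for all } n\ge0,$$ where $B^{(r)}_{n+r,k+r}(\mathbf{a}):=B^{(r)}_{n+r,k+r}(\mathbf{a};\mathbf{a})$.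
   Context: For sequences $\mathbf{a}=(a_1,a_2,\ldots)$, $\mathbf{b}=(b_1,b_2,\ldots)$ and a nonnegative integer $r$, the partial $r$-Bell polynomials $B^{(r)}_{n+r,k+r}(\mathbf{a};\mathbf{b})$ ($n,k\ge0$) are defined by $$\sum_{n\ge k}B^{(r)}_{n+r,k+r}(\mathbf{a};\mathbf{b})\frac{t^n}{n!}=\frac{1}{k!}\Big(\sum_{j\ge1}a_j\frac{t^j}{j!}\Big)^k\Big(\sum_{j\ge0}b_{j+1}\frac{t^j}{j!}\Big)^r,$$ with $B^{(r)}_{n+r,k+r}(\mathbf{a};\mathbf{b})=0$ for $n<k$. -}

module Defs where

open import Level using (Level; _⊔_) renaming (suc to lsuc)
open import Algebra.Bundles using (CommutativeRing)
open import Data.Nat using (ℕ; zero; suc; _∸_; _!; NonZero)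
open import Data.Nat.Properties using (_!≢0)
open import Relation.Nullary using (¬_)

natCast : ∀ {c ℓ} (R : CommutativeRing c ℓ) → ℕ → CommutativeRing.Carrier R
natCast R zero    = CommutativeRing.0# R
natCast R (suc n) = CommutativeRing._+_ R (CommutativeRing.1# R) (natCast R n)

-- A field of characteristic zero (e.g. ℝ), presented as a commutative commRing
-- (with setoid equality ≈) together with multiplicative inverses of
-- nonzero elements and the characteristic-zero axiom.
record CharZeroField (c ℓ : Level) : Set (lsuc (c ⊔ ℓ)) where
  field
    commRing : CommutativeRing c ℓ
  open CommutativeRing commRing public hiding (ring; zero)
  field
    inv        : (x : Carrier) → ¬ (x ≈ 0#) → Carrier
    inv-l      : ∀ x (p : ¬ (x ≈ 0#)) → inv x p * x ≈ 1#
    charZero   : ∀ n → ¬ (natCast commRing (suc n) ≈ 0#)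

module Series {c ℓ} (F : CharZeroField c ℓ) where
  open CharZeroField F

  PS : Set c
  PS = ℕ → Carrier

  sumTo : ℕ → (ℕ → Carrier) → Carrier
  sumTo zero    f = f zero
  sumTo (suc n) f = sumTo n f + f (suc n)

  invNZ : (n : ℕ) → .{{NonZero n}} → Carrier
  invNZ (suc m) = inv (natCast commRing (suc m)) (charZero m)

  invFact : ℕ → Carrier
  invFact k = invNZ (k !) {{k !≢0}}

  mulPS : PS → PS → PS
  mulPS f g n = sumTo n (λ k → f k * g (n ∸ k))

  onePS : PS
  onePS zero    = 1#
  onePS (suc n) = 0#

  X : PS
  X zero          = 0#
  X (suc zero)    = 1#
  X (suc (suc n)) = 0#

  powPS : PS → ℕ → PS
  powPS f zero    = onePS
  powPS f (suc k) = mulPS f (powPS f k)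

  -- composition f(g(t)) (meaningful when g has zero constant term)
  compose : PS → PS → PS
  compose f g n = sumTo n (λ k → f k * powPS g k n)

  -- Sequences a = (a_1, a_2, ...) are encoded as functions s : ℕ → Carrier
  -- with  s j = a_{j+1}.
  -- egfA s = Σ_{j≥1} a_j t^j / j!
  egfA : (ℕ → Carrier) → PS
  egfA s zero    = 0#
  egfA s (suc j) = s j * invFact (suc j)

  egfB : (ℕ → Carrier) → PS
  egfB s j = s j * invFact j

  -- partial r-Bell polynomial  B^{(r)}_{n+r,k+r}(a; b)
  --   = n! [t^n] (1/k!) A(t)^k B(t)^r
  rBell : ℕ → ℕ → ℕ → (ℕ → Carrier) → (ℕ → Carrier) → Carrier
  rBell r n k a b =
    natCast commRing (n !) * (invFact k * mulPS (powPS (egfA a) k) (powPS (egfB b) r) n)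

  rBell₁ : ℕ → ℕ → ℕ → (ℕ → Carrier) → Carrier
  rBell₁ r n k a = rBell r n k a a

-- Let M and N be the matrices of partial r-Bell polynomials of a and ā. Column j of M
-- has exponential generating function Aʲ Bʳ / j!, where B = A′, and row n of N is
-- n! times the coefficient of tⁿ in Āᵏ B̄ʳ / k!. Hence the (n, j) entry of N M is
-- n!/j! times the coefficient of tⁿ in (Aʲ Bʳ)(Ā) B̄ʳ = tʲ (B(Ā) B̄)ʳ, and
-- B(Ā) B̄ = (A ∘ Ā)′ = 1 by the chain rule. So N M = I; since M is lower triangular,
-- U = M V implies V = N U, and the converse is the same argument with a and ā swapped.

module Submission where

open import Defs
open import Data.Nat using (ℕ)
open import Function.Bundles using (_⇔_)
open import Relation.Nullary using (¬_)
open import Data.Nat as ℕ using (zero; suc; _∸_; _!; NonZero; _≤_; _<_; z≤n; s≤s)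
import Data.Nat.Properties as ℕ
open import Data.Sum using (inj₁; inj₂)
open import Relation.Binary.PropositionalEquality as ≡ using (_≡_)
import Algebra.Properties.CommutativeSemigroup as CommSemigroupProperties
import Algebra.Solver.CommutativeMonoid as CommMonoidSolver
open import Function.Bundles using (mk⇔)

module _ {c ℓ} (F : CharZeroField c ℓ) where
  open CharZeroField F
  open Series F
  open import Relation.Binary.Reasoning.Setoid setoid
  open CommSemigroupProperties +-commutativeSemigroup using (interchange)
  open CommSemigroupProperties *-commutativeSemigroup using (x∙yz≈y∙xz)

  sumTo-cong≤ : ∀ n {f g : ℕ → Carrier} → (∀ k → k ≤ n → f k ≈ g k) → sumTo n f ≈ sumTo n g
  sumTo-cong≤ zero    f≈g = f≈g 0 z≤n
  sumTo-cong≤ (suc n) f≈g =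
    +-cong (sumTo-cong≤ n (λ k k≤n → f≈g k (ℕ.m≤n⇒m≤1+n k≤n))) (f≈g (suc n) ℕ.≤-refl)

  sumTo-cong : ∀ n {f g : ℕ → Carrier} → (∀ k → f k ≈ g k) → sumTo n f ≈ sumTo n g
  sumTo-cong n f≈g = sumTo-cong≤ n (λ k _ → f≈g k)

  sumTo-zero : ∀ n {f : ℕ → Carrier} → (∀ k → k ≤ n → f k ≈ 0#) → sumTo n f ≈ 0#
  sumTo-zero zero    f≈0 = f≈0 0 z≤n
  sumTo-zero (suc n) f≈0 =
    trans (+-cong (sumTo-zero n (λ k k≤n → f≈0 k (ℕ.m≤n⇒m≤1+n k≤n))) (f≈0 (suc n) ℕ.≤-refl))
          (+-identityˡ 0#)

  sumTo-+ : ∀ n (f g : ℕ → Carrier) → sumTo n (λ k → f k + g k) ≈ sumTo n f + sumTo n g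
  sumTo-+ zero    f g = refl
  sumTo-+ (suc n) f g = trans (+-congʳ (sumTo-+ n f g)) (interchange _ _ _ _)

  *-distribˡ-sumTo : ∀ n x (f : ℕ → Carrier) → x * sumTo n f ≈ sumTo n (λ k → x * f k)
  *-distribˡ-sumTo zero    x f = refl
  *-distribˡ-sumTo (suc n) x f = trans (distribˡ x _ _) (+-congʳ (*-distribˡ-sumTo n x f))

  *-distribʳ-sumTo : ∀ n x (f : ℕ → Carrier) → sumTo n f * x ≈ sumTo n (λ k → f k * x)
  *-distribʳ-sumTo zero    x f = refl
  *-distribʳ-sumTo (suc n) x f = trans (distribʳ x _ _) (+-congʳ (*-distribʳ-sumTo n x f))

  sumTo-swap : ∀ n m (T : ℕ → ℕ → Carrier) →
               sumTo n (λ i → sumTo m (T i)) ≈ sumTo m (λ k → sumTo n (λ i → T i k))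
  sumTo-swap zero    m T = refl
  sumTo-swap (suc n) m T = trans (+-congʳ (sumTo-swap n m T)) (sym (sumTo-+ m _ _))

  sumTo-suc-head : ∀ n (f : ℕ → Carrier) → sumTo (suc n) f ≈ f 0 + sumTo n (λ k → f (suc k))
  sumTo-suc-head zero    f = refl
  sumTo-suc-head (suc n) f = trans (+-congʳ (sumTo-suc-head n f)) (+-assoc _ _ _)

  sumTo-reverse : ∀ n (f : ℕ → Carrier) → sumTo n f ≈ sumTo n (λ k → f (n ∸ k))
  sumTo-reverse zero    f = refl
  sumTo-reverse (suc n) f = begin
    sumTo n f + f (suc n)                  ≈⟨ +-comm _ _ ⟩
    f (suc n) + sumTo n f                  ≈⟨ +-congˡ (sumTo-reverse n f) ⟩
    f (suc n) + sumTo n (λ k → f (n ∸ k))  ≈⟨ sumTo-suc-head n (λ k → f (suc n ∸ k)) ⟨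
    sumTo (suc n) (λ k → f (suc n ∸ k))    ∎

  sumTo-extend : ∀ {m} n {f : ℕ → Carrier} → m ≤ n →
                 (∀ k → m < k → k ≤ n → f k ≈ 0#) → sumTo n f ≈ sumTo m f
  sumTo-extend zero    z≤n _ = refl
  sumTo-extend (suc n) m≤1+n f≈0 with ℕ.m≤n⇒m<n∨m≡n m≤1+n
  ... | inj₂ ≡.refl = refl
  ... | inj₁ (s≤s m≤n) =
    trans (+-cong (sumTo-extend n m≤n (λ k m<k k≤n → f≈0 k m<k (ℕ.m≤n⇒m≤1+n k≤n)))
                  (f≈0 (suc n) (s≤s m≤n) ℕ.≤-refl))
          (+-identityʳ _)

  sumTo-last : ∀ n {f : ℕ → Carrier} → (∀ k → k < n → f k ≈ 0#) → sumTo n f ≈ f n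
  sumTo-last zero    _   = refl
  sumTo-last (suc n) f≈0 = trans (+-congʳ (sumTo-zero n (λ k k≤n → f≈0 k (s≤s k≤n)))) (+-identityˡ _)

  sumTo-≡ : ∀ (f : ℕ → Carrier) {m n} → m ≡ n → sumTo m f ≈ sumTo n f
  sumTo-≡ f ≡.refl = refl

  sumTo-triangle : ∀ n (T : ℕ → ℕ → Carrier) →
    sumTo n (λ i → sumTo i (λ k → T k i)) ≈ sumTo n (λ k → sumTo (n ∸ k) (λ j → T k (k ℕ.+ j)))
  sumTo-triangle zero    T = refl
  sumTo-triangle (suc n) T = begin
    sumTo n (λ i → sumTo i (λ k → T k i)) + (sumTo n (λ k → T k (suc n)) + T (suc n) (suc n))
      ≈⟨ +-congʳ (sumTo-triangle n T) ⟩
    rows n + (sumTo n (λ k → T k (suc n)) + T (suc n) (suc n))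
      ≈⟨ +-assoc _ _ _ ⟨
    (rows n + sumTo n (λ k → T k (suc n))) + T (suc n) (suc n)
      ≈⟨ +-cong (sym (sumTo-+ n _ _)) (reflexive (≡.cong (T (suc n)) (≡.sym (ℕ.+-identityʳ (suc n))))) ⟩
    sumTo n (λ k → sumTo (n ∸ k) (λ j → T k (k ℕ.+ j)) + T k (suc n)) + T (suc n) (suc n ℕ.+ 0)
      ≈⟨ +-cong (sumTo-cong≤ n extendRow) (sumTo-≡ (λ j → T (suc n) (suc n ℕ.+ j)) (≡.sym (ℕ.n∸n≡0 n))) ⟩
    sumTo n (λ k → sumTo (suc n ∸ k) (λ j → T k (k ℕ.+ j)))
      + sumTo (n ∸ n) (λ j → T (suc n) (suc n ℕ.+ j)) ∎
    where
    rows : ℕ → Carrier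
    rows n = sumTo n (λ k → sumTo (n ∸ k) (λ j → T k (k ℕ.+ j)))
    extendRow : ∀ k → k ≤ n →
      sumTo (n ∸ k) (λ j → T k (k ℕ.+ j)) + T k (suc n) ≈ sumTo (suc n ∸ k) (λ j → T k (k ℕ.+ j))
    extendRow k k≤n = begin
      sumTo (n ∸ k) (λ j → T k (k ℕ.+ j)) + T k (suc n)
        ≈⟨ +-congˡ (reflexive (≡.cong (T k) (≡.sym k+[1+n∸k]≡1+n))) ⟩
      sumTo (suc (n ∸ k)) (λ j → T k (k ℕ.+ j))
        ≈⟨ sumTo-≡ (λ j → T k (k ℕ.+ j)) (≡.sym (ℕ.+-∸-assoc 1 k≤n)) ⟩
      sumTo (suc n ∸ k) (λ j → T k (k ℕ.+ j)) ∎
      where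
      k+[1+n∸k]≡1+n : k ℕ.+ suc (n ∸ k) ≡ suc n
      k+[1+n∸k]≡1+n = ≡.trans (ℕ.+-suc k (n ∸ k)) (≡.cong suc (ℕ.m+[n∸m]≡n k≤n))

  infix 4 _≋_
  _≋_ : PS → PS → Set ℓ
  f ≋ g = ∀ n → f n ≈ g n

  ≋-refl : ∀ {f} → f ≋ f
  ≋-refl n = refl

  ≋-sym : ∀ {f g} → f ≋ g → g ≋ f
  ≋-sym f≋g n = sym (f≋g n)

  ≋-trans : ∀ {f g h} → f ≋ g → g ≋ h → f ≋ h
  ≋-trans f≋g g≋h n = trans (f≋g n) (g≋h n)

  mulPS-cong : ∀ {f f′ g g′} → f ≋ f′ → g ≋ g′ → mulPS f g ≋ mulPS f′ g′
  mulPS-cong f≋f′ g≋g′ n = sumTo-cong n (λ k → *-cong (f≋f′ k) (g≋g′ (n ∸ k)))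

  mulPS-congˡ : ∀ {f f′} g → f ≋ f′ → mulPS f g ≋ mulPS f′ g
  mulPS-congˡ g f≋f′ = mulPS-cong f≋f′ (≋-refl {g})

  mulPS-congʳ : ∀ f {g g′} → g ≋ g′ → mulPS f g ≋ mulPS f g′
  mulPS-congʳ f = mulPS-cong (≋-refl {f})

  mulPS-comm : ∀ f g → mulPS f g ≋ mulPS g f
  mulPS-comm f g n = trans (sumTo-reverse n _) (sumTo-cong≤ n (λ k k≤n →
    trans (*-comm _ _) (*-congʳ (reflexive (≡.cong g (ℕ.m∸[m∸n]≡n k≤n))))))

  mulPS-assoc : ∀ f g h → mulPS (mulPS f g) h ≋ mulPS f (mulPS g h)
  mulPS-assoc f g h n = begin
    sumTo n (λ i → sumTo i (λ k → f k * g (i ∸ k)) * h (n ∸ i))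
      ≈⟨ sumTo-cong n (λ i → *-distribʳ-sumTo i _ _) ⟩
    sumTo n (λ i → sumTo i (λ k → (f k * g (i ∸ k)) * h (n ∸ i)))
      ≈⟨ sumTo-triangle n (λ k i → (f k * g (i ∸ k)) * h (n ∸ i)) ⟩
    sumTo n (λ k → sumTo (n ∸ k) (λ j → (f k * g ((k ℕ.+ j) ∸ k)) * h (n ∸ (k ℕ.+ j))))
      ≈⟨ sumTo-cong n (λ k → sumTo-cong (n ∸ k) (λ j → trans (*-assoc _ _ _)
           (*-congˡ (*-cong (reflexive (≡.cong g (ℕ.m+n∸m≡n k j)))
                            (reflexive (≡.cong h (≡.sym (ℕ.∸-+-assoc n k j)))))))) ⟩
    sumTo n (λ k → sumTo (n ∸ k) (λ j → f k * (g j * h ((n ∸ k) ∸ j))))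
      ≈⟨ sumTo-cong n (λ k → *-distribˡ-sumTo (n ∸ k) _ _) ⟨
    sumTo n (λ k → f k * sumTo (n ∸ k) (λ j → g j * h ((n ∸ k) ∸ j))) ∎

  mulPS-identityˡ : ∀ g → mulPS onePS g ≋ g
  mulPS-identityˡ g zero    = *-identityˡ _
  mulPS-identityˡ g (suc n) =
    trans (sumTo-suc-head n _)
          (trans (+-cong (*-identityˡ _) (sumTo-zero n (λ k _ → zeroˡ _))) (+-identityʳ _))

  mulPS-identityʳ : ∀ g → mulPS g onePS ≋ g
  mulPS-identityʳ g = ≋-trans (mulPS-comm g onePS) (mulPS-identityˡ g)

  mulPS-scaleʳ : ∀ f g x → mulPS f (λ m → x * g m) ≋ (λ n → x * mulPS f g n)
  mulPS-scaleʳ f g x n =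
    trans (sumTo-cong n (λ k → x∙yz≈y∙xz _ _ _)) (sym (*-distribˡ-sumTo n _ _))

  powPS-cong : ∀ {f g} → f ≋ g → ∀ k → powPS f k ≋ powPS g k
  powPS-cong f≋g zero    = ≋-refl
  powPS-cong f≋g (suc k) = mulPS-cong f≋g (powPS-cong f≋g k)

  powPS-+ : ∀ f i j → powPS f (i ℕ.+ j) ≋ mulPS (powPS f i) (powPS f j)
  powPS-+ f zero    j = ≋-sym (mulPS-identityˡ _)
  powPS-+ f (suc i) j =
    ≋-trans (mulPS-congʳ f (powPS-+ f i j)) (≋-sym (mulPS-assoc f (powPS f i) (powPS f j)))

  mulPS-interchange : ∀ f g h k → mulPS (mulPS f g) (mulPS h k) ≋ mulPS (mulPS f h) (mulPS g k)
  mulPS-interchange f g h k n = begin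
    mulPS (mulPS f g) (mulPS h k) n  ≈⟨ mulPS-assoc f g (mulPS h k) n ⟩
    mulPS f (mulPS g (mulPS h k)) n  ≈⟨ mulPS-congʳ f (≋-sym (mulPS-assoc g h k)) n ⟩
    mulPS f (mulPS (mulPS g h) k) n  ≈⟨ mulPS-congʳ f (mulPS-congˡ k (mulPS-comm g h)) n ⟩
    mulPS f (mulPS (mulPS h g) k) n  ≈⟨ mulPS-congʳ f (mulPS-assoc h g k) n ⟩
    mulPS f (mulPS h (mulPS g k)) n  ≈⟨ mulPS-assoc f h (mulPS g k) n ⟨
    mulPS (mulPS f h) (mulPS g k) n  ∎

  powPS-mulPS : ∀ f g r → powPS (mulPS f g) r ≋ mulPS (powPS f r) (powPS g r)
  powPS-mulPS f g zero    = ≋-sym (mulPS-identityˡ _)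
  powPS-mulPS f g (suc r) =
    ≋-trans (mulPS-congʳ (mulPS f g) (powPS-mulPS f g r))
            (mulPS-interchange f g (powPS f r) (powPS g r))

  powPS-onePS : ∀ r → powPS onePS r ≋ onePS
  powPS-onePS zero    = ≋-refl
  powPS-onePS (suc r) = ≋-trans (mulPS-congʳ onePS (powPS-onePS r)) (mulPS-identityˡ onePS)

  powPS-vanish : ∀ f → f 0 ≈ 0# → ∀ k n → n < k → powPS f k n ≈ 0#
  powPS-vanish f f₀≈0 (suc k) n (s≤s n≤k) = sumTo-zero n term≈0
    where
    term≈0 : ∀ i → i ≤ n → f i * powPS f k (n ∸ i) ≈ 0#
    term≈0 zero    _   = trans (*-congʳ f₀≈0) (zeroˡ _)
    term≈0 (suc i) i<n = trans (*-congˡ (powPS-vanish f f₀≈0 k (n ∸ suc i) n∸1+i<k)) (zeroʳ _)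
      where
      n∸1+i<k : n ∸ suc i < k
      n∸1+i<k = ℕ.<-≤-trans (ℕ.∸-monoʳ-< (s≤s z≤n) i<n) n≤k

  mulPS-powPS-vanish : ∀ f g → f 0 ≈ 0# → ∀ k n → n < k → mulPS (powPS f k) g n ≈ 0#
  mulPS-powPS-vanish f g f₀≈0 k n n<k = sumTo-zero n (λ i i≤n →
    trans (*-congʳ (powPS-vanish f f₀≈0 k i (ℕ.≤-<-trans i≤n n<k))) (zeroˡ _))

  compose-congˡ : ∀ {f f′} g → f ≋ f′ → compose f g ≋ compose f′ g
  compose-congˡ g f≋f′ n = sumTo-cong n (λ k → *-congʳ (f≋f′ k))

  -- Terms with k > n of  compose f g  would vanish anyway (g 0 ≈ 0), so the inner sum can be extended to n.
  mulPS-compose : ∀ f g h → g 0 ≈ 0# →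
                  ∀ n → mulPS (compose f g) h n ≈ sumTo n (λ k → f k * mulPS (powPS g k) h n)
  mulPS-compose f g h g₀≈0 n = begin
    sumTo n (λ i → sumTo i (λ k → f k * powPS g k i) * h (n ∸ i))
      ≈⟨ sumTo-cong≤ n (λ i i≤n → *-congʳ (sym (sumTo-extend n i≤n (λ k i<k _ →
           trans (*-congˡ (powPS-vanish g g₀≈0 k i i<k)) (zeroʳ _))))) ⟩
    sumTo n (λ i → sumTo n (λ k → f k * powPS g k i) * h (n ∸ i))
      ≈⟨ sumTo-cong n (λ i → *-distribʳ-sumTo n _ _) ⟩
    sumTo n (λ i → sumTo n (λ k → (f k * powPS g k i) * h (n ∸ i)))
      ≈⟨ sumTo-swap n n _ ⟩
    sumTo n (λ k → sumTo n (λ i → (f k * powPS g k i) * h (n ∸ i)))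
      ≈⟨ sumTo-cong n (λ k → trans (sumTo-cong n (λ i → *-assoc _ _ _)) (sym (*-distribˡ-sumTo n _ _))) ⟩
    sumTo n (λ k → f k * mulPS (powPS g k) h n) ∎

  compose-mulPS : ∀ f₁ f₂ g → g 0 ≈ 0# → compose (mulPS f₁ f₂) g ≋ mulPS (compose f₁ g) (compose f₂ g)
  compose-mulPS f₁ f₂ g g₀≈0 n = begin
    sumTo n (λ k → sumTo k (λ i → f₁ i * f₂ (k ∸ i)) * powPS g k n)
      ≈⟨ sumTo-cong n (λ k → *-distribʳ-sumTo k _ _) ⟩
    sumTo n (λ k → sumTo k (λ i → (f₁ i * f₂ (k ∸ i)) * powPS g k n))
      ≈⟨ sumTo-triangle n (λ i k → (f₁ i * f₂ (k ∸ i)) * powPS g k n) ⟩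
    sumTo n (λ i → sumTo (n ∸ i) (λ l → (f₁ i * f₂ ((i ℕ.+ l) ∸ i)) * powPS g (i ℕ.+ l) n))
      ≈⟨ sumTo-cong n (λ i → sumTo-cong (n ∸ i) (λ l →
           trans (*-assoc _ _ _) (*-congˡ (*-congʳ (reflexive (≡.cong f₂ (ℕ.m+n∸m≡n i l))))))) ⟩
    sumTo n (λ i → sumTo (n ∸ i) (λ l → f₁ i * (f₂ l * powPS g (i ℕ.+ l) n)))
      ≈⟨ sumTo-cong n (λ i → sym (sumTo-extend n (ℕ.m∸n≤m n i) (λ l n∸i<l _ →
           trans (*-congˡ (trans (*-congˡ (powPS-vanish g g₀≈0 (i ℕ.+ l) n (n<i+l n∸i<l))) (zeroʳ _)))
                 (zeroʳ _)))) ⟩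
    sumTo n (λ i → sumTo n (λ l → f₁ i * (f₂ l * powPS g (i ℕ.+ l) n)))
      ≈⟨ sumTo-cong n (λ i → *-distribˡ-sumTo n _ _) ⟨
    sumTo n (λ i → f₁ i * sumTo n (λ l → f₂ l * powPS g (i ℕ.+ l) n))
      ≈⟨ sumTo-cong n (λ i → *-congˡ (sym (powPS-mulPS-compose i))) ⟩
    sumTo n (λ i → f₁ i * mulPS (powPS g i) (compose f₂ g) n)
      ≈⟨ mulPS-compose f₁ g (compose f₂ g) g₀≈0 n ⟨
    mulPS (compose f₁ g) (compose f₂ g) n ∎
    where
    n<i+l : ∀ {i l} → n ∸ i < l → n < i ℕ.+ l
    n<i+l {i} n∸i<l = ℕ.≤-<-trans (ℕ.m≤n+m∸n n i) (ℕ.+-monoʳ-< i n∸i<l)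
    powPS-mulPS-compose : ∀ i → mulPS (powPS g i) (compose f₂ g) n ≈ sumTo n (λ l → f₂ l * powPS g (i ℕ.+ l) n)
    powPS-mulPS-compose i =
      trans (mulPS-comm (powPS g i) (compose f₂ g) n)
            (trans (mulPS-compose f₂ g (powPS g i) g₀≈0 n)
                   (sumTo-cong n (λ l → *-congˡ (trans (sym (powPS-+ g l i n))
                                                        (reflexive (≡.cong (λ m → powPS g m n) (ℕ.+-comm l i)))))))

  compose-onePS : ∀ g → compose onePS g ≋ onePS
  compose-onePS g zero    = *-identityˡ _
  compose-onePS g (suc n) =
    trans (sumTo-suc-head n _) (trans (+-cong (*-identityˡ _) (sumTo-zero n (λ k _ → zeroˡ _))) (+-identityʳ _))

  compose-powPS : ∀ f g → g 0 ≈ 0# → ∀ r → compose (powPS f r) g ≋ powPS (compose f g) r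
  compose-powPS f g g₀≈0 zero    = compose-onePS g
  compose-powPS f g g₀≈0 (suc r) =
    ≋-trans (compose-mulPS f (powPS f r) g g₀≈0) (mulPS-congʳ (compose f g) (compose-powPS f g g₀≈0 r))

  fromℕ : ℕ → Carrier
  fromℕ = natCast commRing

  fromℕ-+ : ∀ m n → fromℕ (m ℕ.+ n) ≈ fromℕ m + fromℕ n
  fromℕ-+ zero    n = sym (+-identityˡ _)
  fromℕ-+ (suc m) n = trans (+-congˡ (fromℕ-+ m n)) (sym (+-assoc _ _ _))

  fromℕ-* : ∀ m n → fromℕ (m ℕ.* n) ≈ fromℕ m * fromℕ n
  fromℕ-* zero    n = sym (zeroˡ _)
  fromℕ-* (suc m) n =
    trans (fromℕ-+ n (m ℕ.* n)) (trans (+-cong (sym (*-identityˡ _)) (fromℕ-* m n)) (sym (distribʳ _ _ _)))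

  fromℕ-1 : fromℕ 1 ≈ 1#
  fromℕ-1 = +-identityʳ 1#

  fromℕ-!-invFact : ∀ k → fromℕ (k !) * invFact k ≈ 1#
  fromℕ-!-invFact k = fromℕ*invNZ≈1 (k !) {{k ℕ.!≢0}}
    where
    fromℕ*invNZ≈1 : ∀ n .{{_ : NonZero n}} → fromℕ n * invNZ n ≈ 1#
    fromℕ*invNZ≈1 (suc m) = trans (*-comm _ _) (inv-l _ _)

  *-inverse-unique : ∀ {x y z} → x * y ≈ 1# → x * z ≈ 1# → y ≈ z
  *-inverse-unique {x} {y} {z} xy≈1 xz≈1 = begin
    y            ≈⟨ *-identityˡ y ⟨
    1# * y       ≈⟨ *-congʳ xz≈1 ⟨
    (x * z) * y  ≈⟨ *-assoc x z y ⟩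
    x * (z * y)  ≈⟨ x∙yz≈y∙xz x z y ⟩
    z * (x * y)  ≈⟨ *-congˡ xy≈1 ⟩
    z * 1#       ≈⟨ *-identityʳ z ⟩
    z            ∎

  fromℕ-suc-invFact : ∀ n → fromℕ (suc n) * invFact (suc n) ≈ invFact n
  fromℕ-suc-invFact n = *-inverse-unique {x = fromℕ (n !)} n!*[1+n]/[1+n]!≈1 (fromℕ-!-invFact n)
    where
    n!*[1+n]/[1+n]!≈1 : fromℕ (n !) * (fromℕ (suc n) * invFact (suc n)) ≈ 1#
    n!*[1+n]/[1+n]!≈1 = trans (sym (*-assoc _ _ _))
      (trans (*-congʳ (trans (*-comm _ _) (sym (fromℕ-* (suc n) (n !))))) (fromℕ-!-invFact (suc n)))

  deriv : PS → PS
  deriv f n = fromℕ (suc n) * f (suc n)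

  deriv-cong : ∀ {f g} → f ≋ g → deriv f ≋ deriv g
  deriv-cong f≋g n = *-congˡ (f≋g (suc n))

  deriv-egfA : ∀ s → deriv (egfA s) ≋ egfB s
  deriv-egfA s n = trans (x∙yz≈y∙xz _ _ _) (*-congˡ (fromℕ-suc-invFact n))

  deriv-onePS : deriv onePS ≋ (λ _ → 0#)
  deriv-onePS n = zeroʳ _

  deriv-X : deriv X ≋ onePS
  deriv-X zero    = trans (*-identityʳ _) fromℕ-1
  deriv-X (suc n) = zeroʳ _

  deriv-mulPS : ∀ f g → deriv (mulPS f g) ≋ (λ n → mulPS (deriv f) g n + mulPS f (deriv g) n)
  deriv-mulPS f g n = begin
    fromℕ (suc n) * sumTo (suc n) (λ i → f i * g (suc n ∸ i))
      ≈⟨ *-distribˡ-sumTo (suc n) _ _ ⟩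
    sumTo (suc n) (λ i → fromℕ (suc n) * (f i * g (suc n ∸ i)))
      ≈⟨ sumTo-cong≤ (suc n) (λ i i≤1+n → trans (*-congʳ (split i≤1+n)) (distribʳ _ _ _)) ⟩
    sumTo (suc n) (λ i → fromℕ i * (f i * g (suc n ∸ i)) + fromℕ (suc n ∸ i) * (f i * g (suc n ∸ i)))
      ≈⟨ sumTo-+ (suc n) _ _ ⟩
    sumTo (suc n) (λ i → fromℕ i * (f i * g (suc n ∸ i)))
      + sumTo (suc n) (λ i → fromℕ (suc n ∸ i) * (f i * g (suc n ∸ i)))
      ≈⟨ +-cong derivLeft derivRight ⟩
    mulPS (deriv f) g n + mulPS f (deriv g) n ∎
    where
    split : ∀ {i} → i ≤ suc n → fromℕ (suc n) ≈ fromℕ i + fromℕ (suc n ∸ i)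
    split {i} i≤1+n = trans (reflexive (≡.cong fromℕ (≡.sym (ℕ.m+[n∸m]≡n i≤1+n)))) (fromℕ-+ i (suc n ∸ i))
    derivLeft : sumTo (suc n) (λ i → fromℕ i * (f i * g (suc n ∸ i))) ≈ mulPS (deriv f) g n
    derivLeft = trans (sumTo-suc-head n _)
      (trans (+-congʳ (zeroˡ _)) (trans (+-identityˡ _) (sumTo-cong n (λ i → sym (*-assoc _ _ _)))))
    shifted : ∀ {m j} → m ≡ suc j → ∀ x → fromℕ m * (x * g m) ≈ x * (fromℕ (suc j) * g (suc j))
    shifted ≡.refl x = x∙yz≈y∙xz _ _ _
    derivRight : sumTo (suc n) (λ i → fromℕ (suc n ∸ i) * (f i * g (suc n ∸ i))) ≈ mulPS f (deriv g) n
    derivRight =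
      trans (+-cong (sumTo-cong≤ n (λ i i≤n → shifted (ℕ.+-∸-assoc 1 i≤n) (f i)))
                    (trans (*-congʳ (reflexive (≡.cong fromℕ (ℕ.n∸n≡0 n)))) (zeroˡ _)))
            (+-identityʳ _)

  deriv-powPS : ∀ f k → deriv (powPS f (suc k)) ≋ (λ n → fromℕ (suc k) * mulPS (powPS f k) (deriv f) n)
  deriv-powPS f zero n = begin
    deriv (mulPS f onePS) n        ≈⟨ deriv-cong (mulPS-identityʳ f) n ⟩
    deriv f n                      ≈⟨ mulPS-identityˡ (deriv f) n ⟨
    mulPS onePS (deriv f) n        ≈⟨ *-identityˡ _ ⟨
    1# * mulPS onePS (deriv f) n   ≈⟨ *-congʳ fromℕ-1 ⟨
    fromℕ 1 * mulPS onePS (deriv f) n ∎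
  deriv-powPS f (suc k) n = begin
    deriv (mulPS f (powPS f (suc k))) n
      ≈⟨ deriv-mulPS f (powPS f (suc k)) n ⟩
    mulPS (deriv f) (powPS f (suc k)) n + mulPS f (deriv (powPS f (suc k))) n
      ≈⟨ +-cong (mulPS-comm (deriv f) _ n) (mulPS-congʳ f (deriv-powPS f k) n) ⟩
    Y + mulPS f (λ m → fromℕ (suc k) * mulPS (powPS f k) (deriv f) m) n
      ≈⟨ +-congˡ (mulPS-scaleʳ f (mulPS (powPS f k) (deriv f)) (fromℕ (suc k)) n) ⟩
    Y + fromℕ (suc k) * mulPS f (mulPS (powPS f k) (deriv f)) n
      ≈⟨ +-congˡ (*-congˡ (mulPS-assoc f (powPS f k) (deriv f) n)) ⟨
    Y + fromℕ (suc k) * Y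
      ≈⟨ +-congʳ (*-identityˡ Y) ⟨
    1# * Y + fromℕ (suc k) * Y
      ≈⟨ distribʳ Y _ _ ⟨
    fromℕ (suc (suc k)) * Y ∎
    where
    Y : Carrier
    Y = mulPS (powPS f (suc k)) (deriv f) n

  deriv-compose : ∀ f g → g 0 ≈ 0# → deriv (compose f g) ≋ mulPS (compose (deriv f) g) (deriv g)
  deriv-compose f g g₀≈0 n = begin
    fromℕ (suc n) * sumTo (suc n) (λ k → f k * powPS g k (suc n))
      ≈⟨ trans (*-distribˡ-sumTo (suc n) _ _) (sumTo-cong (suc n) (λ k → x∙yz≈y∙xz _ _ _)) ⟩
    sumTo (suc n) (λ k → f k * deriv (powPS g k) n)
      ≈⟨ sumTo-suc-head n _ ⟩
    f 0 * deriv onePS n + sumTo n (λ k → f (suc k) * deriv (powPS g (suc k)) n)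
      ≈⟨ +-cong (trans (*-congˡ (deriv-onePS n)) (zeroʳ _))
                (sumTo-cong n (λ k → trans (*-congˡ (deriv-powPS g k n)) (sym (*-assoc _ _ _)))) ⟩
    0# + sumTo n (λ k → (f (suc k) * fromℕ (suc k)) * mulPS (powPS g k) (deriv g) n)
      ≈⟨ trans (+-identityˡ _) (sumTo-cong n (λ k → *-congʳ (*-comm _ _))) ⟩
    sumTo n (λ k → deriv f k * mulPS (powPS g k) (deriv g) n)
      ≈⟨ mulPS-compose (deriv f) g (deriv g) g₀≈0 n ⟨
    mulPS (compose (deriv f) g) (deriv g) n ∎

  mulPS-X-suc : ∀ f n → mulPS X f (suc n) ≈ f n
  mulPS-X-suc f zero    = trans (+-cong (zeroˡ _) (*-identityˡ _)) (+-identityˡ _)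
  mulPS-X-suc f (suc n) = begin
    mulPS X f (suc (suc n))
      ≈⟨ sumTo-suc-head (suc n) _ ⟩
    0# * f (suc (suc n)) + sumTo (suc n) (λ k → X (suc k) * f (suc n ∸ k))
      ≈⟨ +-cong (zeroˡ _) (sumTo-suc-head n _) ⟩
    0# + (1# * f (suc n) + sumTo n (λ k → X (suc (suc k)) * f (n ∸ k)))
      ≈⟨ trans (+-identityˡ _) (+-cong (*-identityˡ _) (sumTo-zero n (λ k _ → zeroˡ _))) ⟩
    f (suc n) + 0#
      ≈⟨ +-identityʳ _ ⟩
    f (suc n) ∎

  powPS-X : ∀ j m → powPS X j (j ℕ.+ m) ≈ onePS m
  powPS-X zero    m = refl
  powPS-X (suc j) m = trans (mulPS-X-suc (powPS X j) (j ℕ.+ m)) (powPS-X j m)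

  rBell₁-vanish : ∀ r a {n k} → n < k → rBell₁ r n k a ≈ 0#
  rBell₁-vanish r a {n} {k} n<k =
    trans (*-congˡ (trans (*-congˡ (mulPS-powPS-vanish (egfA a) (powPS (egfB a) r) refl k n n<k)) (zeroʳ _))) (zeroʳ _)

  triangular-inverse : ∀ (M N : ℕ → ℕ → Carrier) →
    (∀ {n k} → n < k → M n k ≈ 0#) →
    (∀ {n j} → j < n → sumTo n (λ k → N n k * M k j) ≈ 0#) →
    (∀ n → sumTo n (λ k → N n k * M k n) ≈ 1#) →
    (U V : ℕ → Carrier) → (∀ n → U n ≈ sumTo n (λ k → M n k * V k)) →
    ∀ n → V n ≈ sumTo n (λ k → N n k * U k)
  triangular-inverse M N M-upper≈0 NM-off≈0 NM-diag≈1 U V U≈MV n = sym (begin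
    sumTo n (λ k → N n k * U k)
      ≈⟨ sumTo-cong n (λ k → *-congˡ (U≈MV k)) ⟩
    sumTo n (λ k → N n k * sumTo k (λ j → M k j * V j))
      ≈⟨ sumTo-cong≤ n (λ k k≤n → *-congˡ (sym (sumTo-extend n k≤n (λ j k<j _ →
           trans (*-congʳ (M-upper≈0 k<j)) (zeroˡ _))))) ⟩
    sumTo n (λ k → N n k * sumTo n (λ j → M k j * V j))
      ≈⟨ sumTo-cong n (λ k → trans (*-distribˡ-sumTo n _ _) (sumTo-cong n (λ j → sym (*-assoc _ _ _)))) ⟩
    sumTo n (λ k → sumTo n (λ j → (N n k * M k j) * V j))
      ≈⟨ sumTo-swap n n _ ⟩
    sumTo n (λ j → sumTo n (λ k → (N n k * M k j) * V j))
      ≈⟨ sumTo-cong n (λ j → sym (*-distribʳ-sumTo n _ _)) ⟩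
    sumTo n (λ j → sumTo n (λ k → N n k * M k j) * V j)
      ≈⟨ sumTo-last n (λ j j<n → trans (*-congʳ (NM-off≈0 j<n)) (zeroˡ _)) ⟩
    sumTo n (λ k → N n k * M k n) * V n
      ≈⟨ *-congʳ (NM-diag≈1 n) ⟩
    1# * V n
      ≈⟨ *-identityˡ _ ⟩
    V n ∎)

  module RBellInversion (r : ℕ) (a ā : ℕ → Carrier)
                        (A∘Ā≋X : compose (egfA a) (egfA ā) ≋ X) where
    A Ā Bʳ B̄ʳ : PS
    A = egfA a
    Ā = egfA ā
    Bʳ = powPS (egfB a) r
    B̄ʳ = powPS (egfB ā) r

    egfB-compose-inverse : mulPS (compose (egfB a) Ā) (egfB ā) ≋ onePS
    egfB-compose-inverse n = begin
      mulPS (compose (egfB a) Ā) (egfB ā) n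
        ≈⟨ mulPS-cong (compose-congˡ Ā (deriv-egfA a)) (deriv-egfA ā) n ⟨
      mulPS (compose (deriv A) Ā) (deriv Ā) n  ≈⟨ deriv-compose A Ā refl n ⟨
      deriv (compose A Ā) n                    ≈⟨ deriv-cong A∘Ā≋X n ⟩
      deriv X n                                ≈⟨ deriv-X n ⟩
      onePS n                                  ∎

    egfBʳ-compose-inverse : mulPS (compose Bʳ Ā) B̄ʳ ≋ onePS
    egfBʳ-compose-inverse n = begin
      mulPS (compose Bʳ Ā) B̄ʳ n                    ≈⟨ mulPS-congˡ B̄ʳ (compose-powPS (egfB a) Ā refl r) n ⟩
      mulPS (powPS (compose (egfB a) Ā) r) B̄ʳ n    ≈⟨ powPS-mulPS (compose (egfB a) Ā) (egfB ā) r n ⟨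
      powPS (mulPS (compose (egfB a) Ā) (egfB ā)) r n ≈⟨ powPS-cong egfB-compose-inverse r n ⟩
      powPS onePS r n                               ≈⟨ powPS-onePS r n ⟩
      onePS n                                       ∎

    column : ℕ → PS
    column j = mulPS (powPS A j) Bʳ

    column-compose-inverse : ∀ j → mulPS (compose (column j) Ā) B̄ʳ ≋ powPS X j
    column-compose-inverse j n = begin
      mulPS (compose (column j) Ā) B̄ʳ n
        ≈⟨ mulPS-congˡ B̄ʳ (compose-mulPS (powPS A j) Bʳ Ā refl) n ⟩
      mulPS (mulPS (compose (powPS A j) Ā) (compose Bʳ Ā)) B̄ʳ n
        ≈⟨ mulPS-congˡ B̄ʳ (mulPS-congˡ (compose Bʳ Ā)
             (≋-trans (compose-powPS A Ā refl j) (powPS-cong A∘Ā≋X j))) n ⟩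
      mulPS (mulPS (powPS X j) (compose Bʳ Ā)) B̄ʳ n
        ≈⟨ mulPS-assoc (powPS X j) (compose Bʳ Ā) B̄ʳ n ⟩
      mulPS (powPS X j) (mulPS (compose Bʳ Ā) B̄ʳ) n
        ≈⟨ mulPS-congʳ (powPS X j) egfBʳ-compose-inverse n ⟩
      mulPS (powPS X j) onePS n
        ≈⟨ mulPS-identityʳ (powPS X j) n ⟩
      powPS X j n ∎

    M N : ℕ → ℕ → Carrier
    M n k = rBell₁ r n k a
    N n k = rBell₁ r n k ā

    rearrange : ∀ x y z w p q → (x * (y * p)) * (z * (w * q)) ≈ ((x * w) * (q * p)) * (z * y)
    rearrange = solve 6 (λ x y z w p q → (x ⊕ (y ⊕ p)) ⊕ (z ⊕ (w ⊕ q)) ⊜ ((x ⊕ w) ⊕ (q ⊕ p)) ⊕ (z ⊕ y)) refl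
      where open CommMonoidSolver *-commutativeMonoid

    N*M : ∀ n j → sumTo n (λ k → N n k * M k j) ≈ (fromℕ (n !) * invFact j) * powPS X j n
    N*M n j = begin
      sumTo n (λ k → N n k * M k j)
        ≈⟨ sumTo-cong n (λ k → trans (rearrange _ _ _ _ _ _)
             (trans (*-congˡ (fromℕ-!-invFact k)) (*-identityʳ _))) ⟩
      sumTo n (λ k → (fromℕ (n !) * invFact j) * (column j k * mulPS (powPS Ā k) B̄ʳ n))
        ≈⟨ *-distribˡ-sumTo n _ _ ⟨
      (fromℕ (n !) * invFact j) * sumTo n (λ k → column j k * mulPS (powPS Ā k) B̄ʳ n)
        ≈⟨ *-congˡ (mulPS-compose (column j) Ā B̄ʳ refl n) ⟨
      (fromℕ (n !) * invFact j) * mulPS (compose (column j) Ā) B̄ʳ n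
        ≈⟨ *-congˡ (column-compose-inverse j n) ⟩
      (fromℕ (n !) * invFact j) * powPS X j n ∎

    N*M-off : ∀ {n j} → j < n → sumTo n (λ k → N n k * M k j) ≈ 0#
    N*M-off {suc n} {j} (s≤s j≤n) = begin
      sumTo (suc n) (λ k → N (suc n) k * M k j)
        ≈⟨ N*M (suc n) j ⟩
      (fromℕ (suc n !) * invFact j) * powPS X j (suc n)
        ≈⟨ *-congˡ (reflexive (≡.cong (powPS X j) (≡.sym j+[1+n∸j]≡1+n))) ⟩
      (fromℕ (suc n !) * invFact j) * powPS X j (j ℕ.+ suc (n ∸ j))
        ≈⟨ *-congˡ (powPS-X j (suc (n ∸ j))) ⟩
      (fromℕ (suc n !) * invFact j) * 0#
        ≈⟨ zeroʳ _ ⟩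
      0# ∎
      where
      j+[1+n∸j]≡1+n : j ℕ.+ suc (n ∸ j) ≡ suc n
      j+[1+n∸j]≡1+n = ≡.trans (ℕ.+-suc j (n ∸ j)) (≡.cong suc (ℕ.m+[n∸m]≡n j≤n))

    N*M-diag : ∀ n → sumTo n (λ k → N n k * M k n) ≈ 1#
    N*M-diag n = begin
      sumTo n (λ k → N n k * M k n)                   ≈⟨ N*M n n ⟩
      (fromℕ (n !) * invFact n) * powPS X n n
        ≈⟨ *-cong (fromℕ-!-invFact n) (reflexive (≡.cong (powPS X n) (≡.sym (ℕ.+-identityʳ n)))) ⟩
      1# * powPS X n (n ℕ.+ 0)                        ≈⟨ *-congˡ (powPS-X n 0) ⟩
      1# * 1#                                         ≈⟨ *-identityˡ 1# ⟩
      1#                                              ∎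

    inversion : (U V : ℕ → Carrier) → (∀ n → U n ≈ sumTo n (λ k → M n k * V k)) →
                ∀ n → V n ≈ sumTo n (λ k → N n k * U k)
    inversion = triangular-inverse M N (rBell₁-vanish r a) N*M-off N*M-diag

-- The hypothesis a₁ ≠ 0 only guarantees that Ā exists; here Ā is given together with both composition identities.
mainTheorem2 : ∀ {c ℓ} (F : CharZeroField c ℓ) →
    let open CharZeroField F
        open Series F
    in (r : ℕ) (a abar : ℕ → Carrier) →
       ¬ (a 0 ≈ 0#) →
       (∀ n → compose (egfA a) (egfA abar) n ≈ X n) →
       (∀ n → compose (egfA abar) (egfA a) n ≈ X n) →
       (U V : ℕ → Carrier) →
       ((∀ n → U n ≈ sumTo n (λ k → rBell₁ r n k a * V k))
         ⇔ (∀ n → V n ≈ sumTo n (λ k → rBell₁ r n k abar * U k)))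
mainTheorem2 F r a abar _ A∘Ā≋X Ā∘A≋X U V =
  mk⇔ (RBellInversion.inversion F r a abar A∘Ā≋X U V)
      (RBellInversion.inversion F r abar a Ā∘A≋X V U)
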